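{- Let $\mathcal{A}$ be a monoid of games (a set of games containing $0$ and closed under disjunctive sum) with $\{\cdot\mid 2\}\in\mathcal{A}$. Then $\mathcal{A}$ is Left weak.
   Context: Games are short partizan game forms under the misère convention (a player unable to move wins); $0=\{\cdot\mid\cdot\}$, $1=\{0\mid\cdot\}$, $2=\{1\mid\cdot\}$; $\{\cdot\mid 2\}$ has no Left option and the single Right option $2$. $o_L(G)\in\{\mathscr{L},\mathscr{R}\}$ is the winner when Left moves first. Augmented forms (Siegel): game forms where each subposition may carry a Left and/or Right tombstone (markers, not options); an augmented form is Left end-like if it has no Left options or carries a Left tombstone, and a player to move on a position that is end-like for them wins immediately; $G+H$ carries a Left tombstone iff both summands are Left end-like and at least one carries a Left tombstone (symmetrically for Right). An augmented form $G$ is Left $\mathcal{A}$-strong if $o_L(G+X)=\mathscr{L}$ for every Left end (game with no Left options) $X\in\mathcal{A}$. $\mathcal{A}$ is Left weak if an augmented form is Left $\mathcal{A}$-strong exactly when it is Left end-like. -}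

module Defs where

open import Data.Nat using (ℕ; zero; suc; _+_)
open import Data.Fin using (Fin; splitAt)
open import Data.Bool using (Bool; true; false; _∧_; _∨_; if_then_else_)
open import Data.Sum using ([_,_]′)
open import Data.Product using (_×_)
open import Relation.Binary.PropositionalEquality using (_≡_)

data Game : Set where
  game : (m n : ℕ) → (Fin m → Game) → (Fin n → Game) → Game

nLeft : Game → ℕ
nLeft (game m _ _ _) = m

LeftEnd : Game → Set
LeftEnd X = nLeft X ≡ 0

noOpt : Fin 0 → Game
noOpt ()

zeroG : Game
zeroG = game 0 0 noOpt noOpt

oneG : Game
oneG = game 1 0 (λ _ → zeroG) noOpt

twoG : Game
twoG = game 1 0 (λ _ → oneG) noOpt

overTwo : Game
overTwo = game 0 1 noOpt (λ _ → twoG)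

infixl 6 _⊕_
_⊕_ : Game → Game → Game
game m n GL GR ⊕ game m' n' HL HR =
  game (m + m') (n + n')
    (λ k → [ (λ i → GL i ⊕ game m' n' HL HR) , (λ j → game m n GL GR ⊕ HL j) ]′ (splitAt m k))
    (λ k → [ (λ i → GR i ⊕ game m' n' HL HR) , (λ j → game m n GL GR ⊕ HR j) ]′ (splitAt n k))

record IsMonoidOfGames (𝒜 : Game → Set) : Set where
  field
    has-zero : 𝒜 zeroG
    closed-⊕ : ∀ {G H} → 𝒜 G → 𝒜 H → 𝒜 (G ⊕ H)

-- Augmented forms: every subposition carries a Left tombstone flag and
-- a Right tombstone flag (markers, not options).

data AForm : Set where
  aform : (m n : ℕ) → (tombL tombR : Bool) → (Fin m → AForm) → (Fin n → AForm) → AForm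

aug : Game → AForm
aug (game m n GL GR) = aform m n false false (λ i → aug (GL i)) (λ j → aug (GR j))

isZero : ℕ → Bool
isZero zero = true
isZero (suc _) = false

leftEndLikeᵇ : AForm → Bool
leftEndLikeᵇ (aform m _ tl _ _ _) = tl ∨ isZero m

rightEndLikeᵇ : AForm → Bool
rightEndLikeᵇ (aform _ n _ tr _ _) = tr ∨ isZero n

LeftEndLike : AForm → Set
LeftEndLike G = leftEndLikeᵇ G ≡ true

infixl 6 _+ᴬ_
_+ᴬ_ : AForm → AForm → AForm
aform m n tl tr GL GR +ᴬ aform m' n' tl' tr' HL HR =
  aform (m + m') (n + n')
    ((leftEndLikeᵇ (aform m n tl tr GL GR) ∧ leftEndLikeᵇ (aform m' n' tl' tr' HL HR)) ∧ (tl ∨ tl'))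
    ((rightEndLikeᵇ (aform m n tl tr GL GR) ∧ rightEndLikeᵇ (aform m' n' tl' tr' HL HR)) ∧ (tr ∨ tr'))
    (λ k → [ (λ i → GL i +ᴬ aform m' n' tl' tr' HL HR) , (λ j → aform m n tl tr GL GR +ᴬ HL j) ]′ (splitAt m k))
    (λ k → [ (λ i → GR i +ᴬ aform m' n' tl' tr' HL HR) , (λ j → aform m n tl tr GL GR +ᴬ HR j) ]′ (splitAt n k))

-- Misère outcomes (a player to move on a position that is end-like for
-- them wins immediately).

data Player : Set where
  𝓛 𝓡 : Player

anyFin : ∀ {n} → (Fin n → Bool) → Bool
anyFin {zero} f = false
anyFin {suc n} f = f Fin.zero ∨ anyFin (λ i → f (Fin.suc i))

isL : Player → Bool
isL 𝓛 = true
isL 𝓡 = false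

isR : Player → Bool
isR 𝓛 = false
isR 𝓡 = true

oL : AForm → Player
oR : AForm → Player
oL (aform m n tl tr GL GR) =
  if tl ∨ isZero m then 𝓛
  else (if anyFin (λ i → isL (oR (GL i))) then 𝓛 else 𝓡)
oR (aform m n tl tr GL GR) =
  if tr ∨ isZero n then 𝓡
  else (if anyFin (λ j → isR (oL (GR j))) then 𝓡 else 𝓛)

LeftStrong : (Game → Set) → AForm → Set
LeftStrong 𝒜 G = ∀ X → 𝒜 X → LeftEnd X → oL (G +ᴬ aug X) ≡ 𝓛

LeftWeak : (Game → Set) → Set
LeftWeak 𝒜 = ∀ G → (LeftStrong 𝒜 G → LeftEndLike G) × (LeftEndLike G → LeftStrong 𝒜 G)

{-# OPTIONS --safe #-}
module Submission where

open import Defs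
open import Data.Nat using (ℕ; zero; suc; _+_; _⊔_; _≤_; _<_; s≤s)
open import Data.Nat.Properties
  using (≤-trans; <-trans; ≤-reflexive; ≤-pred; n<1+n; m≤m⊔n; m≤n⊔m; +-suc; m+n≡0⇒m≡0; m+n≡0⇒n≡0)
open import Data.Fin using (Fin; splitAt; _↑ˡ_; _↑ʳ_)
open import Data.Fin.Properties using (splitAt-↑ˡ; splitAt-↑ʳ)
open import Data.Bool using (Bool; true; false; _∧_; _∨_)
open import Data.Bool.Properties using (∨-zeroʳ; ∧-zeroʳ)
open import Data.Sum using (inj₁; inj₂; [_,_]′)
open import Data.Product using (∃-syntax; _×_; _,_)
open import Relation.Binary.PropositionalEquality using (_≡_; refl; sym; trans; cong; cong₂; subst)

-- A Left end-like G stays Left end-like after adding a Left end, so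
-- Left, moving first, wins at once. Conversely let G not be Left end-like and
-- let X be the sum of depth G + 2 copies of {· | 2}, a Left end in 𝒜. In G + X
-- Right keeps Left supplied with moves: as long as she has copies of {· | 2}
-- she answers there, handing Left two more moves in X, and once they are used
-- up Left still has enough moves in X for Right to answer in G until Right runs
-- out of moves and so wins. Left never reaches a Left end-like position.

leftCount rightCount : AForm → ℕ
leftCount (aform m _ _ _ _ _) = m
rightCount (aform _ n _ _ _ _) = n

leftOption : (G : AForm) → Fin (leftCount G) → AForm
leftOption (aform _ _ _ _ GL _) = GL

rightOption : (G : AForm) → Fin (rightCount G) → AForm
rightOption (aform _ _ _ _ _ GR) = GR

[,]′-splitAt-ind : ∀ {A : Set} (P : A → Set) {m n} {f : Fin m → A} {g : Fin n → A} →
                   (∀ i → P (f i)) → (∀ j → P (g j)) → ∀ k → P ([ f , g ]′ (splitAt m k))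
[,]′-splitAt-ind P {m} Pf Pg k with splitAt m k
... | inj₁ i = Pf i
... | inj₂ j = Pg j

[,]′-splitAt-↑ˡ : ∀ {A : Set} {m n} (f : Fin m → A) (g : Fin n → A) i →
                  [ f , g ]′ (splitAt m (i ↑ˡ n)) ≡ f i
[,]′-splitAt-↑ˡ {m = m} {n} f g i rewrite splitAt-↑ˡ m i n = refl

[,]′-splitAt-↑ʳ : ∀ {A : Set} {m n} (f : Fin m → A) (g : Fin n → A) j →
                  [ f , g ]′ (splitAt m (m ↑ʳ j)) ≡ g j
[,]′-splitAt-↑ʳ {m = m} {n} f g j rewrite splitAt-↑ʳ m n j = refl

leftEndLike-+ᴬ-aug : ∀ G Y → leftEndLikeᵇ (G +ᴬ aug Y) ≡ leftEndLikeᵇ G ∧ isZero (nLeft Y)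
leftEndLike-+ᴬ-aug (aform _       _ true  _ _ _) (game zero    _ _ _) = refl
leftEndLike-+ᴬ-aug (aform zero    _ true  _ _ _) (game (suc _) _ _ _) = refl
leftEndLike-+ᴬ-aug (aform (suc _) _ true  _ _ _) (game (suc _) _ _ _) = refl
leftEndLike-+ᴬ-aug (aform zero    _ false _ _ _) (game zero    _ _ _) = refl
leftEndLike-+ᴬ-aug (aform zero    _ false _ _ _) (game (suc _) _ _ _) = refl
leftEndLike-+ᴬ-aug (aform (suc _) _ false _ _ _) (game _       _ _ _) = refl

anyFin-false : ∀ {n} (p : Fin n → Bool) → (∀ i → p i ≡ false) → anyFin p ≡ false
anyFin-false {zero}  p all-false = refl
anyFin-false {suc n} p all-false rewrite all-false Fin.zero =
  anyFin-false (λ i → p (Fin.suc i)) (λ i → all-false (Fin.suc i))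

anyFin-true : ∀ {n} (p : Fin n → Bool) i → p i ≡ true → anyFin p ≡ true
anyFin-true p Fin.zero    pi≡true rewrite pi≡true = refl
anyFin-true p (Fin.suc i) pi≡true rewrite anyFin-true (λ i → p (Fin.suc i)) i pi≡true = ∨-zeroʳ _

oL-leftEndLike : ∀ G → LeftEndLike G → oL G ≡ 𝓛
oL-leftEndLike (aform m n tl tr GL GR) endLike rewrite endLike = refl

oL≡𝓡 : ∀ G → leftEndLikeᵇ G ≡ false → (∀ i → oR (leftOption G i) ≡ 𝓡) → oL G ≡ 𝓡
oL≡𝓡 (aform m n tl tr GL GR) notEndLike rightWins
  rewrite notEndLike | anyFin-false (λ i → isL (oR (GL i))) (λ i → cong isL (rightWins i)) = refl

oR≡𝓡-noRightOption : ∀ G → rightCount G ≡ 0 → oR G ≡ 𝓡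
oR≡𝓡-noRightOption (aform m zero tl tr GL GR) refl rewrite ∨-zeroʳ tr = refl

oR≡𝓡-rightOption : ∀ G j → oL (rightOption G j) ≡ 𝓡 → oR G ≡ 𝓡
oR≡𝓡-rightOption (aform m n tl tr GL GR) j rightWins with tr ∨ isZero n
... | true = refl
... | false rewrite anyFin-true (λ j → isR (oL (GR j))) j (cong isR rightWins) = refl

oL-+ᴬ≡𝓡 : ∀ G H → leftEndLikeᵇ (G +ᴬ H) ≡ false →
          (∀ i → oR (leftOption G i +ᴬ H) ≡ 𝓡) → (∀ j → oR (G +ᴬ leftOption H j) ≡ 𝓡) →
          oL (G +ᴬ H) ≡ 𝓡
oL-+ᴬ≡𝓡 G@(aform _ _ _ _ _ _) H@(aform _ _ _ _ _ _) notEndLike inG inH =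
  oL≡𝓡 (G +ᴬ H) notEndLike ([,]′-splitAt-ind (λ K → oR K ≡ 𝓡) inG inH)

oR-+ᴬ≡𝓡ˡ : ∀ G H i → oL (rightOption G i +ᴬ H) ≡ 𝓡 → oR (G +ᴬ H) ≡ 𝓡
oR-+ᴬ≡𝓡ˡ G@(aform _ _ _ _ _ GR) H@(aform _ n' _ _ _ HR) i rightWins =
  oR≡𝓡-rightOption (G +ᴬ H) (i ↑ˡ n')
    (trans (cong oL ([,]′-splitAt-↑ˡ (λ i → GR i +ᴬ H) (λ j → G +ᴬ HR j) i)) rightWins)

oR-+ᴬ≡𝓡ʳ : ∀ G H j → oL (G +ᴬ rightOption H j) ≡ 𝓡 → oR (G +ᴬ H) ≡ 𝓡
oR-+ᴬ≡𝓡ʳ G@(aform _ n _ _ _ GR) H@(aform _ _ _ _ _ HR) j rightWins =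
  oR≡𝓡-rightOption (G +ᴬ H) (n ↑ʳ j)
    (trans (cong oL ([,]′-splitAt-↑ʳ (λ i → GR i +ᴬ H) (λ j → G +ᴬ HR j) j)) rightWins)

maxFin : ∀ {n} → (Fin n → ℕ) → ℕ
maxFin {zero}  f = 0
maxFin {suc n} f = f Fin.zero ⊔ maxFin (λ i → f (Fin.suc i))

≤-maxFin : ∀ {n} (f : Fin n → ℕ) i → f i ≤ maxFin f
≤-maxFin f Fin.zero    = m≤m⊔n _ _
≤-maxFin f (Fin.suc i) = ≤-trans (≤-maxFin (λ i → f (Fin.suc i)) i) (m≤n⊔m _ _)

depth : AForm → ℕ
depth (aform m n tl tr GL GR) = suc (maxFin (λ i → depth (GL i)) ⊔ maxFin (λ j → depth (GR j)))

depth-leftOption : ∀ G i → depth (leftOption G i) < depth G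
depth-leftOption (aform m n tl tr GL GR) i =
  s≤s (≤-trans (≤-maxFin (λ i → depth (GL i)) i) (m≤m⊔n _ _))

depth-rightOption : ∀ G j → depth (rightOption G j) < depth G
depth-rightOption (aform m n tl tr GL GR) j =
  s≤s (≤-trans (≤-maxFin (λ j → depth (GR j)) j) (m≤n⊔m _ _))

-- Reserve r f Y: Y plays like r copies of {· | 2} together with f further Left
-- moves; a Right move spends one copy and hands Left the two moves of 2.
Reserve : ℕ → ℕ → Game → Set
Reserve r f (game m n YL YR) =
  (m ≡ 0 → f ≡ 0) × (n ≡ 0 → r ≡ 0) ×
  (∀ i → ∃[ f' ] f ≡ suc f' × Reserve r f' (YL i)) ×
  (∀ j → ∃[ r' ] r ≡ suc r' × Reserve r' (suc (suc f)) (YR j))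

Reserve-leftEnd : ∀ {r} Y → Reserve r 0 Y → LeftEnd Y
Reserve-leftEnd (game zero    _ _ _) _ = refl
Reserve-leftEnd (game (suc _) _ _ _) (_ , _ , leftMoves , _) with leftMoves Fin.zero
... | _ , () , _

Reserve-hasLeftOption : ∀ {r f} Y → Reserve r (suc f) Y → isZero (nLeft Y) ≡ false
Reserve-hasLeftOption (game zero    _ _ _) (noLeft , _) with noLeft refl
... | ()
Reserve-hasLeftOption (game (suc _) _ _ _) _ = refl

Reserve-+ᴬ-notLeftEndLike : ∀ {r f} H Y → Reserve r (suc f) Y → leftEndLikeᵇ (H +ᴬ aug Y) ≡ false
Reserve-+ᴬ-notLeftEndLike H Y res =
  trans (leftEndLike-+ᴬ-aug H Y)
        (trans (cong (leftEndLikeᵇ H ∧_) (Reserve-hasLeftOption Y res)) (∧-zeroʳ _))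

Reserve-⊕ : ∀ {r f r' f'} Y Z → Reserve r f Y → Reserve r' f' Z → Reserve (r + r') (f + f') (Y ⊕ Z)
Reserve-⊕ {r} {f} {r'} {f'} Y@(game m n YL YR) Z@(game m' n' ZL ZR)
          resY@(noLeftY , noRightY , leftY , rightY) resZ@(noLeftZ , noRightZ , leftZ , rightZ) =
    (λ e → cong₂ _+_ (noLeftY (m+n≡0⇒m≡0 m e)) (noLeftZ (m+n≡0⇒n≡0 m e)))
  , (λ e → cong₂ _+_ (noRightY (m+n≡0⇒m≡0 n e)) (noRightZ (m+n≡0⇒n≡0 n e)))
  , [,]′-splitAt-ind (λ K → ∃[ f'' ] f + f' ≡ suc f'' × Reserve (r + r') f'' K)
      (λ i → let (f₀ , e , res) = leftY i in
             f₀ + f' , cong (_+ f') e , Reserve-⊕ (YL i) Z res resZ)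
      (λ j → let (f₁ , e , res) = leftZ j in
             f + f₁ , trans (cong (f +_) e) (+-suc f f₁) , Reserve-⊕ Y (ZL j) resY res)
  , [,]′-splitAt-ind (λ K → ∃[ r'' ] r + r' ≡ suc r'' × Reserve r'' (suc (suc (f + f'))) K)
      (λ i → let (r₀ , e , res) = rightY i in
             r₀ + r' , cong (_+ r') e , Reserve-⊕ (YR i) Z res resZ)
      (λ j → let (r₁ , e , res) = rightZ j in
             r + r₁ , trans (cong (r +_) e) (+-suc r r₁) ,
             subst (λ f'' → Reserve (r + r₁) f'' (Y ⊕ ZR j)) (+-suc-suc f f')
                   (Reserve-⊕ Y (ZR j) resY res))
  where
  +-suc-suc : ∀ a b → a + suc (suc b) ≡ suc (suc (a + b))
  +-suc-suc a b = trans (+-suc a (suc b)) (cong suc (+-suc a b))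

copies : ℕ → Game → Game
copies zero    G = zeroG
copies (suc k) G = G ⊕ copies k G

copies-closed : ∀ {𝒜} → IsMonoidOfGames 𝒜 → ∀ {G} → 𝒜 G → ∀ k → 𝒜 (copies k G)
copies-closed 𝒜-monoid 𝒜G zero    = IsMonoidOfGames.has-zero 𝒜-monoid
copies-closed 𝒜-monoid 𝒜G (suc k) =
  IsMonoidOfGames.closed-⊕ 𝒜-monoid 𝒜G (copies-closed 𝒜-monoid 𝒜G k)

Reserve-zero : Reserve 0 0 zeroG
Reserve-zero = (λ _ → refl) , (λ _ → refl) , (λ ()) , (λ ())

Reserve-overTwo : Reserve 1 0 overTwo
Reserve-overTwo = (λ _ → refl) , (λ ()) , (λ ()) , (λ _ → 0 , refl , Reserve-two)
  where
  Reserve-one : Reserve 0 1 oneG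
  Reserve-one = (λ ()) , (λ _ → refl) , (λ _ → 0 , refl , Reserve-zero) , (λ ())
  Reserve-two : Reserve 0 2 twoG
  Reserve-two = (λ ()) , (λ _ → refl) , (λ _ → 1 , refl , Reserve-one) , (λ ())

Reserve-copies-overTwo : ∀ k → Reserve k 0 (copies k overTwo)
Reserve-copies-overTwo zero    = Reserve-zero
Reserve-copies-overTwo (suc k) =
  Reserve-⊕ overTwo (copies k overTwo) Reserve-overTwo (Reserve-copies-overTwo k)

-- A Left move in Y lowers f + r but not depth H, hence the extra unit when Left is to move.
oR-+ᴬ-Reserve≡𝓡 : ∀ {r f} H Y → Reserve r f Y → depth H < f + r → oR (H +ᴬ aug Y) ≡ 𝓡
oL-+ᴬ-Reserve≡𝓡 : ∀ {r f} H Y → Reserve r f Y → leftEndLikeᵇ (H +ᴬ aug Y) ≡ false →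
                  suc (depth H) < f + r → oL (H +ᴬ aug Y) ≡ 𝓡

oR-+ᴬ-Reserve≡𝓡 {suc r} H (game _ zero _ _) (_ , noRight , _) _ with noRight refl
... | ()
oR-+ᴬ-Reserve≡𝓡 {suc r} {f} H@(aform _ _ _ _ _ _) Y@(game _ (suc _) _ YR) (_ , _ , _ , rightY) depthH<
  with rightY Fin.zero
... | _ , refl , res =
  oR-+ᴬ≡𝓡ʳ H (aug Y) Fin.zero
    (oL-+ᴬ-Reserve≡𝓡 H (YR Fin.zero) res
      (Reserve-+ᴬ-notLeftEndLike H (YR Fin.zero) res)
      (s≤s (≤-trans depthH< (≤-reflexive (+-suc f r)))))
oR-+ᴬ-Reserve≡𝓡 {zero} H (game _ (suc _) _ _) (_ , _ , _ , rightY) _ with rightY Fin.zero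
... | _ , () , _
oR-+ᴬ-Reserve≡𝓡 {zero} H@(aform _ zero _ _ _ _) Y@(game _ zero _ _) _ _ =
  oR≡𝓡-noRightOption (H +ᴬ aug Y) refl
oR-+ᴬ-Reserve≡𝓡 {zero} {zero} H@(aform _ (suc _) _ _ _ _) Y@(game _ zero _ _) _ ()
oR-+ᴬ-Reserve≡𝓡 {zero} {suc f} H@(aform _ (suc _) _ _ _ HR) Y@(game _ zero _ _) res depthH< =
  oR-+ᴬ≡𝓡ˡ H (aug Y) Fin.zero
    (oL-+ᴬ-Reserve≡𝓡 (HR Fin.zero) Y res
      (Reserve-+ᴬ-notLeftEndLike (HR Fin.zero) Y res)
      (≤-trans (s≤s (depth-rightOption H Fin.zero)) depthH<))

oL-+ᴬ-Reserve≡𝓡 {r} {f} H@(aform _ _ _ _ HL _) Y@(game _ _ YL _) res@(_ , _ , leftY , _)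
                notEndLike depthH< =
  oL-+ᴬ≡𝓡 H (aug Y) notEndLike
    (λ i → oR-+ᴬ-Reserve≡𝓡 (HL i) Y res
             (<-trans (depth-leftOption H i) (<-trans (n<1+n _) depthH<)))
    (λ j → leftMove j (leftY j))
  where
  leftMove : ∀ j → ∃[ f' ] f ≡ suc f' × Reserve r f' (YL j) → oR (H +ᴬ aug (YL j)) ≡ 𝓡
  leftMove j (f' , refl , res') = oR-+ᴬ-Reserve≡𝓡 H (YL j) res' (≤-pred depthH<)

oL-+ᴬ-copies-overTwo≡𝓡 : ∀ G → leftEndLikeᵇ G ≡ false →
                          oL (G +ᴬ aug (copies (suc (suc (depth G))) overTwo)) ≡ 𝓡
oL-+ᴬ-copies-overTwo≡𝓡 G notEndLike =
  oL-+ᴬ-Reserve≡𝓡 G X (Reserve-copies-overTwo k)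
    (trans (leftEndLike-+ᴬ-aug G X) (cong (_∧ isZero (nLeft X)) notEndLike)) (n<1+n _)
  where
  k = suc (suc (depth G))
  X = copies k overTwo

leftEndLike⇒LeftStrong : ∀ 𝒜 G → LeftEndLike G → LeftStrong 𝒜 G
leftEndLike⇒LeftStrong 𝒜 G endLike X@(game _ _ _ _) _ refl =
  oL-leftEndLike (G +ᴬ aug X) (trans (leftEndLike-+ᴬ-aug G X) (cong (_∧ true) endLike))

theorem5p9 : (𝒜 : Game → Set) → IsMonoidOfGames 𝒜 → 𝒜 overTwo → LeftWeak 𝒜
theorem5p9 𝒜 𝒜-monoid 𝒜-overTwo G = LeftStrong⇒leftEndLike , leftEndLike⇒LeftStrong 𝒜 G
  where
  k = suc (suc (depth G))
  X = copies k overTwo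

  LeftStrong⇒leftEndLike : LeftStrong 𝒜 G → LeftEndLike G
  LeftStrong⇒leftEndLike strong with leftEndLikeᵇ G in endLikeᵇ
  ... | true  = refl
  ... | false with () ← trans (sym (strong X (copies-closed 𝒜-monoid 𝒜-overTwo k)
                                            (Reserve-leftEnd X (Reserve-copies-overTwo k))))
                              (oL-+ᴬ-copies-overTwo≡𝓡 G endLikeᵇ)
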